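{- For all non-negative integers $n$, \[T_{n+4}^2=1+\sum_{k=0}^n\left\{3T_{k+2}^2+9T_{k+1}^2+4\sum_{i=2}^k(T_{k+4-i}+T_{k+3-i})T_i^2\right\}.\]
   Context: Tribonacci numbers: $T_n=T_{n-1}+T_{n-2}+T_{n-3}+\delta_{n,2}$ for all integers $n$, with $T_n=0$ for $n<2$; $\delta_{i,j}$ is $1$ if $i=j$ and $0$ otherwise. Empty sums are zero. -}

module Defs where

open import Data.Nat using (ℕ; zero; suc; _+_; _*_; _<ᵇ_)
open import Data.Bool using (if_then_else_)

-- Tribonacci numbers for non-negative indices:
-- T 0 = 0, T 1 = 0, T 2 = 1, T (n+3) = T (n+2) + T (n+1) + T n.
-- (T n = 0 for negative n, so for n ≥ 0 the recurrence with δ_{n,2}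
-- gives exactly these values.)
T : ℕ → ℕ
T zero = 0
T (suc zero) = 0
T (suc (suc zero)) = 1
T (suc (suc (suc n))) = T (suc (suc n)) + T (suc n) + T n

-- Σ[ a ≤ i ≤ b ] f i  written  sumFromTo a b f : sum of f i for a ≤ i ≤ b
-- (empty, i.e. 0, when b < a).
sumFromTo : ℕ → ℕ → (ℕ → ℕ) → ℕ
sumFromTo a zero f = if 0 <ᵇ a then 0 else f 0
sumFromTo a (suc b) f = sumFromTo a b f + (if suc b <ᵇ a then 0 else f (suc b))

{-# OPTIONS --safe #-}
-- Write s k = T_k², and let c = weight ⋆ s be the convolution of s with weight m = T (m+4) + T (m+3).
-- By telescoping, the theorem amounts to  s (k+4) = s (k+3) + 3 s (k+2) + 9 s (k+1) + 4 c k.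
-- Since weight satisfies the Tribonacci recurrence, so does c up to the boundary terms
-- 2 s (k+1) + 3 s (k+2) + 3 s (k+3), while the squares satisfy
-- s (n+6) + s (n+2) + s n = 2 s (n+5) + 3 s (n+4) + 6 s (n+3).  So both sides of the identity solve
-- the same inhomogeneous Tribonacci recurrence, and they agree for k = 0, 1, 2.
module Submission where

open import Defs
open import Data.Nat using (ℕ; zero; suc; _+_; _*_; _∸_; _≤_; _<ᵇ_)
open import Data.Nat.Properties
  using (+-assoc; +-comm; +-cancelʳ-≡; *-distribʳ-+; *-zeroʳ; +-∸-assoc; n∸n≡0; ≤-refl; m≤n⇒m≤1+n;
         +-commutativeSemigroup)
open import Data.Nat.Tactic.RingSolver using (solve-∀; solve)
open import Data.Bool using (if_then_else_)
open import Function using (_∘_)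
open import Data.List using (_∷_; [])
open import Relation.Binary.PropositionalEquality
  using (_≡_; refl; sym; trans; cong; cong₂; module ≡-Reasoning)
open import Algebra.Properties.CommutativeSemigroup +-commutativeSemigroup using (interchange)

open ≡-Reasoning

sumFromTo-cong : ∀ a b {f g : ℕ → ℕ} → (∀ {i} → i ≤ b → f i ≡ g i) →
                 sumFromTo a b f ≡ sumFromTo a b g
sumFromTo-cong a zero    f≗g = cong (if 0 <ᵇ a then 0 else_) (f≗g ≤-refl)
sumFromTo-cong a (suc b) f≗g =
  cong₂ _+_ (sumFromTo-cong a b (f≗g ∘ m≤n⇒m≤1+n))
            (cong (if suc b <ᵇ a then 0 else_) (f≗g ≤-refl))

sumFromTo-suc-lower : ∀ a b (f : ℕ → ℕ) → f a ≡ 0 → sumFromTo (suc a) b f ≡ sumFromTo a b f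
sumFromTo-suc-lower zero    zero    f fa≡0 = sym fa≡0
sumFromTo-suc-lower (suc a) zero    f fa≡0 = refl
sumFromTo-suc-lower a       (suc b) f fa≡0 =
  cong₂ _+_ (sumFromTo-suc-lower a b f fa≡0) (lastTerm a b f fa≡0)
  where
  lastTerm : ∀ a b (f : ℕ → ℕ) → f a ≡ 0 →
             (if b <ᵇ a then 0 else f (suc b)) ≡ (if suc b <ᵇ a then 0 else f (suc b))
  lastTerm zero          b       f fa≡0 = refl
  lastTerm (suc zero)    zero    f fa≡0 = sym fa≡0
  lastTerm (suc (suc a)) zero    f fa≡0 = refl
  lastTerm (suc a)       (suc b) f fa≡0 = lastTerm a b (f ∘ suc) fa≡0

sumFromTo-telescope : (x f : ℕ → ℕ) → (∀ k → x (suc k) ≡ x k + f k) →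
                      ∀ n → x (suc n) ≡ x 0 + sumFromTo 0 n f
sumFromTo-telescope x f step zero    = step 0
sumFromTo-telescope x f step (suc n) = begin
  x (suc (suc n))                           ≡⟨ step (suc n) ⟩
  x (suc n) + f (suc n)                     ≡⟨ cong (_+ f (suc n)) (sumFromTo-telescope x f step n) ⟩
  x 0 + sumFromTo 0 n f + f (suc n)         ≡⟨ +-assoc (x 0) _ _ ⟩
  x 0 + sumFromTo 0 (suc n) f               ∎

infixl 7 _⋆_

-- (w ⋆ a) k = Σ_{i ≤ k} w (k - i) * a i, peeling off the term i = k so that no subtraction occurs.
_⋆_ : (ℕ → ℕ) → (ℕ → ℕ) → ℕ → ℕ
(w ⋆ a) zero    = w 0 * a 0
(w ⋆ a) (suc k) = (w ∘ suc ⋆ a) k + w 0 * a (suc k)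

⋆-sumFromTo : ∀ (w a : ℕ → ℕ) k → (w ⋆ a) k ≡ sumFromTo 0 k (λ i → w (k ∸ i) * a i)
⋆-sumFromTo w a zero    = refl
⋆-sumFromTo w a (suc k) = cong₂ _+_
  (trans (⋆-sumFromTo (w ∘ suc) a k)
         (sumFromTo-cong 0 k (λ {i} i≤k → cong (λ m → w m * a i) (sym (+-∸-assoc 1 i≤k)))))
  (cong (λ m → w m * a (suc k)) (sym (n∸n≡0 k)))

⋆-congˡ : ∀ {u v : ℕ → ℕ} → (∀ m → u m ≡ v m) → ∀ a k → (u ⋆ a) k ≡ (v ⋆ a) k
⋆-congˡ u≗v a zero    = cong (_* a 0) (u≗v 0)
⋆-congˡ u≗v a (suc k) = cong₂ _+_ (⋆-congˡ (u≗v ∘ suc) a k) (cong (_* a (suc k)) (u≗v 0))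

⋆-distribʳ-+ : ∀ (u v a : ℕ → ℕ) k → ((λ m → u m + v m) ⋆ a) k ≡ (u ⋆ a) k + (v ⋆ a) k
⋆-distribʳ-+ u v a zero    = *-distribʳ-+ (a 0) (u 0) (v 0)
⋆-distribʳ-+ u v a (suc k) = begin
  ((λ m → u (suc m) + v (suc m)) ⋆ a) k + (u 0 + v 0) * a (suc k)
    ≡⟨ cong₂ _+_ (⋆-distribʳ-+ (u ∘ suc) (v ∘ suc) a k) (*-distribʳ-+ (a (suc k)) (u 0) (v 0)) ⟩
  ((u ∘ suc ⋆ a) k + (v ∘ suc ⋆ a) k) + (u 0 * a (suc k) + v 0 * a (suc k))
    ≡⟨ interchange ((u ∘ suc ⋆ a) k) ((v ∘ suc ⋆ a) k) (u 0 * a (suc k)) (v 0 * a (suc k)) ⟩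
  (u ⋆ a) (suc k) + (v ⋆ a) (suc k) ∎

Tribonacci : (ℕ → ℕ) → Set
Tribonacci w = ∀ m → w (3 + m) ≡ w (2 + m) + w (1 + m) + w m

Tribonacci-+ : ∀ {u v} → Tribonacci u → Tribonacci v → Tribonacci (λ m → u m + v m)
Tribonacci-+ {u} {v} ru rv m = begin
  u (3 + m) + v (3 + m)
    ≡⟨ cong₂ _+_ (ru m) (rv m) ⟩
  (u (2 + m) + u (1 + m) + u m) + (v (2 + m) + v (1 + m) + v m)
    ≡⟨ interchange (u (2 + m) + u (1 + m)) (u m) (v (2 + m) + v (1 + m)) (v m) ⟩
  (u (2 + m) + u (1 + m) + (v (2 + m) + v (1 + m))) + (u m + v m)
    ≡⟨ cong (_+ (u m + v m)) (interchange (u (2 + m)) (u (1 + m)) (v (2 + m)) (v (1 + m))) ⟩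
  (u (2 + m) + v (2 + m)) + (u (1 + m) + v (1 + m)) + (u m + v m) ∎

⋆-tribonacci : ∀ {w} → Tribonacci w → ∀ a k →
  (w ⋆ a) (3 + k) + (w 1 + w 0) * a (1 + k) + w 0 * a (2 + k)
    ≡ (w ⋆ a) (2 + k) + (w ⋆ a) (1 + k) + (w ⋆ a) k
      + (w 2 * a (1 + k) + w 1 * a (2 + k) + w 0 * a (3 + k))
⋆-tribonacci {w} rec a k = begin
  (w ∘ suc ∘ suc ∘ suc ⋆ a) k + w 2 * p + w 1 * q + w 0 * r + (w 1 + w 0) * p + w 0 * q
    ≡⟨ cong (λ s → s + w 2 * p + w 1 * q + w 0 * r + (w 1 + w 0) * p + w 0 * q) shifted ⟩
  (w ∘ suc ∘ suc ⋆ a) k + (w ∘ suc ⋆ a) k + (w ⋆ a) k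
    + w 2 * p + w 1 * q + w 0 * r + (w 1 + w 0) * p + w 0 * q
    ≡⟨ rearrange ((w ∘ suc ∘ suc ⋆ a) k) ((w ∘ suc ⋆ a) k) ((w ⋆ a) k) (w 0) (w 1) (w 2) p q r ⟩
  ((w ∘ suc ∘ suc ⋆ a) k + w 1 * p + w 0 * q) + ((w ∘ suc ⋆ a) k + w 0 * p) + (w ⋆ a) k
    + (w 2 * p + w 1 * q + w 0 * r) ∎
  where
  p = a (1 + k)
  q = a (2 + k)
  r = a (3 + k)
  shifted : (w ∘ suc ∘ suc ∘ suc ⋆ a) k ≡ (w ∘ suc ∘ suc ⋆ a) k + (w ∘ suc ⋆ a) k + (w ⋆ a) k
  shifted = begin
    (w ∘ suc ∘ suc ∘ suc ⋆ a) k
      ≡⟨ ⋆-congˡ rec a k ⟩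
    ((λ m → w (2 + m) + w (1 + m) + w m) ⋆ a) k
      ≡⟨ ⋆-distribʳ-+ (λ m → w (2 + m) + w (1 + m)) w a k ⟩
    ((λ m → w (2 + m) + w (1 + m)) ⋆ a) k + (w ⋆ a) k
      ≡⟨ cong (_+ (w ⋆ a) k) (⋆-distribʳ-+ (w ∘ suc ∘ suc) (w ∘ suc) a k) ⟩
    (w ∘ suc ∘ suc ⋆ a) k + (w ∘ suc ⋆ a) k + (w ⋆ a) k ∎
  rearrange : ∀ A B C w₀ w₁ w₂ p q r →
    A + B + C + w₂ * p + w₁ * q + w₀ * r + (w₁ + w₀) * p + w₀ * q
      ≡ (A + w₁ * p + w₀ * q) + (B + w₀ * p) + C + (w₂ * p + w₁ * q + w₀ * r)
  rearrange = solve-∀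

module _ (u v f g : ℕ → ℕ)
         (u-rec : ∀ k → u (3 + k) + f k ≡ u (2 + k) + u (1 + k) + u k + g k)
         (v-rec : ∀ k → v (3 + k) + f k ≡ v (2 + k) + v (1 + k) + v k + g k)
         (e₀ : u 0 ≡ v 0) (e₁ : u 1 ≡ v 1) (e₂ : u 2 ≡ v 2) where

  tribonacci-unique : ∀ k → u k ≡ v k
  tribonacci-unique zero                = e₀
  tribonacci-unique (suc zero)          = e₁
  tribonacci-unique (suc (suc zero))    = e₂
  tribonacci-unique (suc (suc (suc k))) = +-cancelʳ-≡ _ _ _ (begin
    u (3 + k) + f k                    ≡⟨ u-rec k ⟩
    u (2 + k) + u (1 + k) + u k + g k
      ≡⟨ cong (_+ g k) (cong₂ _+_ (cong₂ _+_ (tribonacci-unique (suc (suc k)))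
                                             (tribonacci-unique (suc k)))
                                  (tribonacci-unique k)) ⟩
    v (2 + k) + v (1 + k) + v k + g k  ≡⟨ sym (v-rec k) ⟩
    v (3 + k) + f k                    ∎)

T² : ℕ → ℕ
T² n = T n * T n

T²-recurrence : ∀ n →
  T² (6 + n) + T² (2 + n) + T² n ≡ 2 * T² (5 + n) + 3 * T² (4 + n) + 6 * T² (3 + n)
T²-recurrence n = squares (T n) (T (1 + n)) (T (2 + n))
  where
  squares : ∀ x y z →
    let p = z + y + x; q = p + z + y; r = q + p + z; s = r + q + p
    in  s * s + z * z + x * x ≡ 2 * (r * r) + 3 * (q * q) + 6 * (p * p)
  squares = solve-∀

weight : ℕ → ℕ
weight m = T (4 + m) + T (3 + m)

weight-tribonacci : Tribonacci weight
weight-tribonacci = Tribonacci-+ {λ m → T (4 + m)} {λ m → T (3 + m)} (λ _ → refl) (λ _ → refl)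

weight⋆-recurrence : ∀ a k →
  (weight ⋆ a) (3 + k) ≡ (weight ⋆ a) (2 + k) + (weight ⋆ a) (1 + k) + (weight ⋆ a) k
                         + (2 * a (1 + k) + 3 * a (2 + k) + 3 * a (3 + k))
weight⋆-recurrence a k = +-cancelʳ-≡ _ _ _ (begin
  (weight ⋆ a) (3 + k) + (9 * p + 3 * q)     ≡⟨ sym (+-assoc ((weight ⋆ a) (3 + k)) (9 * p) (3 * q)) ⟩
  (weight ⋆ a) (3 + k) + 9 * p + 3 * q       ≡⟨ ⋆-tribonacci weight-tribonacci a k ⟩
  S + (11 * p + 6 * q + 3 * r)               ≡⟨ rearrange S p q r ⟩
  S + (2 * p + 3 * q + 3 * r) + (9 * p + 3 * q) ∎)
  where
  p = a (1 + k)
  q = a (2 + k)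
  r = a (3 + k)
  S = (weight ⋆ a) (2 + k) + (weight ⋆ a) (1 + k) + (weight ⋆ a) k
  rearrange : ∀ S p q r →
    S + (11 * p + 6 * q + 3 * r) ≡ S + (2 * p + 3 * q + 3 * r) + (9 * p + 3 * q)
  rearrange = solve-∀

increment : ℕ → ℕ
increment k = 3 * T² (2 + k) + 9 * T² (1 + k) + 4 * (weight ⋆ T²) k

T²-increment : ∀ k → T² (4 + k) ≡ T² (3 + k) + increment k
T²-increment = tribonacci-unique next predicted f g next-rec predicted-rec refl refl refl
  where
  next predicted f g : ℕ → ℕ
  next      k = T² (4 + k)
  predicted k = T² (3 + k) + increment k
  f         k = T² (3 + k) + T² (1 + k)
  g         k = T² (6 + k) + 2 * T² (5 + k) + 5 * T² (4 + k)

  next-rec : ∀ k → next (3 + k) + f k ≡ next (2 + k) + next (1 + k) + next k + g k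
  next-rec k = begin
    T² (7 + k) + (T² (3 + k) + T² (1 + k))            ≡⟨ sym (+-assoc (T² (7 + k)) _ _) ⟩
    T² (7 + k) + T² (3 + k) + T² (1 + k)              ≡⟨ T²-recurrence (1 + k) ⟩
    2 * T² (6 + k) + 3 * T² (5 + k) + 6 * T² (4 + k)  ≡⟨ split (T² (6 + k)) (T² (5 + k)) (T² (4 + k)) ⟩
    next (2 + k) + next (1 + k) + next k + g k        ∎
    where
    split : ∀ x y z → 2 * x + 3 * y + 6 * z ≡ x + y + z + (x + 2 * y + 5 * z)
    split = solve-∀

  predicted-rec : ∀ k → predicted (3 + k) + f k ≡ predicted (2 + k) + predicted (1 + k) + predicted k + g k
  predicted-rec k =
    substitute (T² (1 + k)) (T² (2 + k)) (T² (3 + k)) (T² (4 + k)) (T² (5 + k)) (T² (6 + k))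
               ((weight ⋆ T²) k) ((weight ⋆ T²) (1 + k)) ((weight ⋆ T²) (2 + k))
               (weight⋆-recurrence T² k)
    where
    substitute : ∀ s₁ s₂ s₃ s₄ s₅ s₆ c₀ c₁ c₂ {c₃} → c₃ ≡ c₂ + c₁ + c₀ + (2 * s₁ + 3 * s₂ + 3 * s₃) →
      s₆ + (3 * s₅ + 9 * s₄ + 4 * c₃) + (s₃ + s₁)
        ≡ s₅ + (3 * s₄ + 9 * s₃ + 4 * c₂) + (s₄ + (3 * s₃ + 9 * s₂ + 4 * c₁))
          + (s₃ + (3 * s₂ + 9 * s₁ + 4 * c₀)) + (s₆ + 2 * s₅ + 5 * s₄)
    substitute s₁ s₂ s₃ s₄ s₅ s₆ c₀ c₁ c₂ refl =
      solve (s₁ ∷ s₂ ∷ s₃ ∷ s₄ ∷ s₅ ∷ s₆ ∷ c₀ ∷ c₁ ∷ c₂ ∷ [])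

weight⋆T²-sumFromTo : ∀ k →
  (weight ⋆ T²) k ≡ sumFromTo 2 k (λ i → (T (k + 4 ∸ i) + T (k + 3 ∸ i)) * (T i * T i))
weight⋆T²-sumFromTo k = begin
  (weight ⋆ T²) k                                ≡⟨ ⋆-sumFromTo weight T² k ⟩
  sumFromTo 0 k (λ i → weight (k ∸ i) * T² i)    ≡⟨ sumFromTo-cong 0 k reindex ⟩
  sumFromTo 0 k summand
    ≡⟨ sym (sumFromTo-suc-lower 0 k summand (*-zeroʳ (T (k + 4) + T (k + 3)))) ⟩
  sumFromTo 1 k summand
    ≡⟨ sym (sumFromTo-suc-lower 1 k summand (*-zeroʳ (T (k + 4 ∸ 1) + T (k + 3 ∸ 1)))) ⟩
  sumFromTo 2 k summand                          ∎
  where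
  summand : ℕ → ℕ
  summand i = (T (k + 4 ∸ i) + T (k + 3 ∸ i)) * T² i
  shift : ∀ j {i} → i ≤ k → j + (k ∸ i) ≡ k + j ∸ i
  shift j {i} i≤k = trans (sym (+-∸-assoc j i≤k)) (cong (_∸ i) (+-comm j k))
  reindex : ∀ {i} → i ≤ k → weight (k ∸ i) * T² i ≡ summand i
  reindex {i} i≤k = cong (_* T² i) (cong₂ _+_ (cong T (shift 4 i≤k)) (cong T (shift 3 i≤k)))

increment-expand : ∀ k → increment k ≡
  3 * (T (k + 2) * T (k + 2)) + 9 * (T (k + 1) * T (k + 1))
  + 4 * sumFromTo 2 k (λ i → (T (k + 4 ∸ i) + T (k + 3 ∸ i)) * (T i * T i))
increment-expand k =
  cong₂ _+_ (cong₂ _+_ (cong (λ m → 3 * T² m) (+-comm 2 k)) (cong (λ m → 9 * T² m) (+-comm 1 k)))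
            (cong (4 *_) (weight⋆T²-sumFromTo k))

mainTheorem7 : ∀ (n : ℕ) →
    T (n + 4) * T (n + 4) ≡
      1 + sumFromTo 0 n (λ k →
            3 * (T (k + 2) * T (k + 2)) + 9 * (T (k + 1) * T (k + 1))
            + 4 * sumFromTo 2 k (λ i →
                (T (k + 4 ∸ i) + T (k + 3 ∸ i)) * (T i * T i)))
mainTheorem7 n =
  trans (cong T² (+-comm n 4))
        (trans (sumFromTo-telescope (λ k → T² (3 + k)) increment T²-increment n)
               (cong (1 +_) (sumFromTo-cong 0 n (λ {k} _ → increment-expand k))))
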